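{- Let $G$ be a graph with an orientation, $t\ge2$, and $\tau$ an automorphism of $G$. For each $\gamma\in C_1(G,\mathbb Z/t\mathbb Z)$, $A_\gamma$ is similar to $A_{\tau(\gamma)}$ and $W_{1,\gamma}$ is similar to $W_{1,\tau(\gamma)}$.
   Context: A graph is connected and finite, loops and multiple edges allowed, vertices $v_1,\dots,v_n$, edges $e_1,\dots,e_m$. Each edge gives two mutually inverse oriented edges; $\mathbf e(0),\mathbf e(1)$ are initial/terminal vertices; $\mathbf E(G)$ is the set of $2m$ oriented edges; an orientation picks a positively oriented $\mathbf e_k$ for each $e_k$. $C_1(G,\mathbb Z/t\mathbb Z)$ is the free module on $\mathbf e_1,\dots,\mathbf e_m$ with $1\cdot\mathbf e^{ -1}=-1\cdot\mathbf e$; $\langle\sum a_k\mathbf e_k,\sum b_k\mathbf e_k\rangle=\sum a_kb_k$. An automorphism $\tau$ consists of permutations of the vertices and of the edges preserving incidence. It acts on oriented edges: for an oriented edge $\mathbf e$ with underlying edge $e$, $\tau(\mathbf e)$ is the oriented edge with underlying edge $\tau(e)$ and initial vertex $\tau(\mathbf e(0))$, and $\tau(\mathbf e^{ -1})=\tau(\mathbf e)^{ -1}$ (for loops either compatible choice). It acts on $C_1$ by $\tau(\sum c_k\mathbf e_k)=\sum c_k\tau(\mathbf e_k)$ (using $1\cdot\mathbf e^{ -1}=-1\cdot\mathbf e$). $\epsilon_t=\exp(2\pi i/t)$; $\chi_\gamma(\mathbf e)=\epsilon_t^{\langle\gamma,1\cdot\mathbf e\rangle}$. $A_\gamma$: $n\times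 n$ with $(i,j)$ entry $\sum\chi_\gamma(\mathbf e)$ over $\mathbf e\in\mathbf E(G)$ from $v_i$ to $v_j$. $\mathbf e$ feeds into $\mathbf e'$ if $\mathbf e'\ne\mathbf e^{ -1}$ and $\mathbf e(1)=\mathbf e'(0)$; $W_{1,\gamma}$: $2m\times2m$ indexed by $\mathbf E(G)$ with $(\mathbf e,\mathbf e')$ entry $\chi_\gamma(\mathbf e)$ if $\mathbf e$ feeds into $\mathbf e'$, else $0$. -}

module Defs where

open import Level using (Level; _⊔_)
open import Data.Nat using (ℕ; zero; suc; _∸_)
open import Data.Fin using (Fin; zero; suc; toℕ; opposite; _≟_)
open import Data.Bool using (Bool; true; false; not; if_then_else_)
import Data.Bool as B
open import Data.Product using (_×_; _,_; proj₁; proj₂; Σ; ∃)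
open import Data.Product.Properties using (≡-dec)
open import Relation.Nullary using (¬_; Dec; yes; no)
open import Relation.Nullary.Decidable using (⌊_⌋)
open import Relation.Binary.PropositionalEquality using (_≡_)
open import Function.Bundles using (_↔_; Inverse)
open import Algebra.Bundles using (CommutativeRing)

-- The chosen
-- orientation gives each edge k its positively oriented version e_k with
-- initial vertex src k and terminal vertex tgt k.  Loops (src k ≡ tgt k)
-- and multiple edges are allowed.

record Graph (n m : ℕ) : Set where
  field
    src : Fin m → Fin n
    tgt : Fin m → Fin n

-- Oriented edges: (k , true) = e_k, (k , false) = e_k^{-1}.
-- E(G) therefore has exactly 2m elements.
OEdge : ℕ → Set
OEdge m = Fin m × Bool

module _ {n m : ℕ} (G : Graph n m) where
  open Graph G

  init : OEdge m → Fin n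
  init (k , true)  = src k
  init (k , false) = tgt k

  term : OEdge m → Fin n
  term (k , true)  = tgt k
  term (k , false) = src k

  data Reachable : Fin n → Fin n → Set where
    here : ∀ {i} → Reachable i i
    step : ∀ {i j} (e : OEdge m) → init e ≡ i → Reachable (term e) j → Reachable i j

  Connected : Set
  Connected = ∀ i j → Reachable i j

  -- The function `pos` records how τ acts on the positively
  -- oriented edges: pos k = true means τ(e_k) = e_{τ k}, pos k = false
  -- means τ(e_k) = e_{τ k}^{-1}.  The incidence condition says that
  -- τ(e_k) has initial vertex τ(e_k(0)) and terminal vertex τ(e_k(1)).
  -- (For non-loops pos is determined by τ; for loops it is the
  -- "either compatible choice".)
  record Automorphism : Set where
    field
      vperm : Fin n ↔ Fin n
      eperm : Fin m ↔ Fin m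
      pos   : Fin m → Bool
    τv = Inverse.to vperm
    τe = Inverse.to eperm
    field
      incidence : ∀ k → (init (τe k , pos k) ≡ τv (src k))
                      × (term (τe k , pos k) ≡ τv (tgt k))

-- Z/tZ is Fin t; negation mod t.
negF : ∀ {t} → Fin t → Fin t
negF {suc n} zero    = zero
negF {suc n} (suc i) = suc (opposite i)

-- C_1(G, Z/tZ): coefficient vectors w.r.t. e_1..e_m
C1 : ℕ → ℕ → Set
C1 m t = Fin m → Fin t

-- action of an automorphism on C_1:
-- τ(Σ c_k e_k) = Σ c_k τ(e_k), τ(e_k) = ± e_{τ k}.
act : ∀ {n m t} {G : Graph n m} → Automorphism G → C1 m t → C1 m t
act τ γ j = if pos k then γ k else negF (γ k)
  where
  open Automorphism τ
  k = Inverse.from eperm j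

pairing : ∀ {m t} → C1 m t → OEdge m → Fin t
pairing γ (k , true)  = γ k
pairing γ (k , false) = negF (γ k)

module Matrices {c ℓ : Level} (R : CommutativeRing c ℓ) where
  open CommutativeRing R using (_≈_; _+_; _*_; 0#; 1#) renaming (Carrier to A)

  _^_ : A → ℕ → A
  x ^ zero  = 1#
  x ^ suc k = x * (x ^ k)

  sumFin : (k : ℕ) → (Fin k → A) → A
  sumFin zero    f = 0#
  sumFin (suc k) f = f zero + sumFin k (λ i → f (suc i))

  sumOE : (m : ℕ) → (OEdge m → A) → A
  sumOE m f = sumFin m (λ k → f (k , true) + f (k , false))

  record Index : Set (Level.suc Level.zero ⊔ c) where
    field
      I    : Set
      Sum  : (I → A) → A
      _≟I_ : (x y : I) → Dec (x ≡ y)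

  FinIx : ℕ → Index
  FinIx k = record { I = Fin k ; Sum = sumFin k ; _≟I_ = _≟_ }

  OEIx : ℕ → Index
  OEIx m = record { I = OEdge m ; Sum = sumOE m ; _≟I_ = ≡-dec _≟_ B._≟_ }

  module _ (X : Index) where
    open Index X

    Mat : Set c
    Mat = I → I → A

    _·_ : Mat → Mat → Mat
    (P · Q) i j = Sum (λ k → P i k * Q k j)

    idM : Mat
    idM i j = if ⌊ i ≟I j ⌋ then 1# else 0#

    _≈M_ : Mat → Mat → Set ℓ
    P ≈M Q = ∀ i j → P i j ≈ Q i j

    Similar : Mat → Mat → Set (c ⊔ ℓ)
    Similar M N = Σ Mat λ P → Σ Mat λ Q →
      ((P · Q) ≈M idM) × ((Q · P) ≈M idM) × (N ≈M ((P · M) · Q))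

  -- The matrices A_γ and W_{1,γ}, with ε playing the role of ε_t.
  module _ {n m : ℕ} (G : Graph n m) (t : ℕ) (ε : A) where

    χ : C1 m t → OEdge m → A
    χ γ e = ε ^ toℕ (pairing γ e)

    Aγ : C1 m t → Fin n → Fin n → A
    Aγ γ i j = sumOE m (λ e →
      if ⌊ init G e ≟ i ⌋ B.∧ ⌊ term G e ≟ j ⌋ then χ γ e else 0#)

    inv : OEdge m → OEdge m
    inv (k , b) = (k , not b)

    feeds : OEdge m → OEdge m → Bool
    feeds e e' = B.not ⌊ ≡-dec _≟_ B._≟_ e' (inv e) ⌋ B.∧ ⌊ term G e ≟ init G e' ⌋

    W1 : C1 m t → OEdge m → OEdge m → A
    W1 γ e e' = if feeds e e' then χ γ e else 0#

{-# OPTIONS --safe #-}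
-- An automorphism τ permutes the vertices and the oriented edges of G, and
-- it preserves initial and terminal vertices, inversion of oriented edges
-- and (by the definition of τ(γ)) the pairing ⟨γ , 1·e⟩.  Hence
-- A_{τ(γ)}(τ i, τ j) = A_γ(i, j) and W_{1,τ(γ)}(τ e, τ e') = W_{1,γ}(e, e'),
-- so both matrices are conjugated by permutation matrices.
module Submission where

open import Defs
open import Level using (_⊔_)
open import Data.Nat using (ℕ; _≤_; zero; suc)
open import Data.Product using (_×_; _,_; proj₁; proj₂)
open import Algebra.Bundles using (CommutativeRing)

open import Data.Bool using (Bool; true; false; not; if_then_else_; _∧_)
open import Data.Bool.Properties using (not-involutive)
import Data.Bool as B
open import Data.Fin using (Fin; punchIn)
import Data.Fin as F
open import Data.Fin.Properties using (opposite-involutive; punchInᵢ≢i)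
open import Data.Product.Properties using (≡-dec)
open import Data.Vec.Functional using (replicate)
open import Function using (_∘_; _↔_; _⇔_; Inverse; mk↔ₛ′; mk⇔)
open import Function.Definitions using (Injective)
open import Function.Properties.Inverse using (↔⇒↣)
open import Function.Bundles using (Injection)
open import Relation.Binary.Definitions using (DecidableEquality)
open import Relation.Binary.PropositionalEquality
  using (_≡_; _≢_; refl; sym; trans; cong; cong₂)
open import Relation.Nullary using (Dec; yes; no; contradiction)
open import Relation.Nullary.Decidable using (⌊_⌋; isYes≗does; does-⇔)
import Algebra.Properties.CommutativeMonoid.Sum as CommutativeMonoidSum

isYes-⇔ : ∀ {a b} {P : Set a} {Q : Set b} → P ⇔ Q →
          (p? : Dec P) (q? : Dec Q) → ⌊ p? ⌋ ≡ ⌊ q? ⌋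
isYes-⇔ P⇔Q p? q? =
  trans (isYes≗does p?) (trans (does-⇔ P⇔Q p? q?) (sym (isYes≗does q?)))

⌊≟⌋-injective : ∀ {a b} {A : Set a} {B : Set b}
                (_≟A_ : DecidableEquality A) (_≟B_ : DecidableEquality B)
                {f : A → B} → Injective _≡_ _≡_ f →
                ∀ x y → ⌊ f x ≟B f y ⌋ ≡ ⌊ x ≟A y ⌋
⌊≟⌋-injective _≟A_ _≟B_ {f} f-inj x y =
  isYes-⇔ (mk⇔ f-inj (cong f)) (f x ≟B f y) (x ≟A y)

↔-injective : ∀ {a b} {A : Set a} {B : Set b} (σ : A ↔ B) → Injective _≡_ _≡_ (Inverse.to σ)
↔-injective σ = Injection.injective (↔⇒↣ σ)

negF-involutive : ∀ {t} (x : Fin t) → negF (negF x) ≡ x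
negF-involutive {suc _} F.zero    = refl
negF-involutive {suc _} (F.suc i) = cong F.suc (opposite-involutive i)

orient : Bool → Bool → Bool
orient p true  = p
orient p false = not p

orient-involutive : ∀ p b → orient p (orient p b) ≡ b
orient-involutive true  true  = refl
orient-involutive false true  = refl
orient-involutive true  false = refl
orient-involutive false false = refl

orient-not : ∀ p b → orient p (not b) ≡ not (orient p b)
orient-not p true  = refl
orient-not p false = sym (not-involutive p)

_≟OE_ : ∀ {m} → DecidableEquality (OEdge m)
_≟OE_ = ≡-dec F._≟_ B._≟_

liftOE : ∀ {m} → (Fin m → Fin m) → (Fin m → Bool) → OEdge m → OEdge m
liftOE π p (k , b) = π k , orient (p k) b

module AutomorphismOnOEdges {n m : ℕ} {G : Graph n m} (τ : Automorphism G) where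
  open Automorphism τ

  τ̂ : OEdge m → OEdge m
  τ̂ = liftOE τe pos

  τ̂⁻¹ : OEdge m → OEdge m
  τ̂⁻¹ = liftOE (Inverse.from eperm) (pos ∘ Inverse.from eperm)

  τ̂-↔ : OEdge m ↔ OEdge m
  τ̂-↔ = mk↔ₛ′ τ̂ τ̂⁻¹ τ̂∘τ̂⁻¹ τ̂⁻¹∘τ̂
    where
    τ̂∘τ̂⁻¹ : ∀ e → τ̂ (τ̂⁻¹ e) ≡ e
    τ̂∘τ̂⁻¹ (j , b) = cong₂ _,_ (Inverse.strictlyInverseˡ eperm j)
                               (orient-involutive (pos (Inverse.from eperm j)) b)
    τ̂⁻¹∘τ̂ : ∀ e → τ̂⁻¹ (τ̂ e) ≡ e
    τ̂⁻¹∘τ̂ (k , b) rewrite Inverse.strictlyInverseʳ eperm k =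
      cong (k ,_) (orient-involutive (pos k) b)

  init-reverse : ∀ k b → init G (k , not b) ≡ term G (k , b)
  init-reverse k true  = refl
  init-reverse k false = refl

  term-reverse : ∀ k b → term G (k , not b) ≡ init G (k , b)
  term-reverse k true  = refl
  term-reverse k false = refl

  init-τ̂ : ∀ e → init G (τ̂ e) ≡ τv (init G e)
  init-τ̂ (k , true)  = proj₁ (incidence k)
  init-τ̂ (k , false) = trans (init-reverse (τe k) (pos k)) (proj₂ (incidence k))

  term-τ̂ : ∀ e → term G (τ̂ e) ≡ τv (term G e)
  term-τ̂ (k , true)  = proj₂ (incidence k)
  term-τ̂ (k , false) = trans (term-reverse (τe k) (pos k)) (proj₁ (incidence k))

  τ̂-reverse : ∀ k b → τ̂ (k , not b) ≡ (τe k , not (orient (pos k) b))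
  τ̂-reverse k b = cong (τe k ,_) (orient-not (pos k) b)

  act-τe : ∀ {t} (γ : C1 m t) k →
           act τ γ (τe k) ≡ (if pos k then γ k else negF (γ k))
  act-τe γ k = cong (λ j → if pos j then γ j else negF (γ j))
                    (Inverse.strictlyInverseʳ eperm k)

  pairing-τ̂ : ∀ {t} (γ : C1 m t) e → pairing (act τ γ) (τ̂ e) ≡ pairing γ e
  pairing-τ̂ γ (k , b) with pos k | act-τe γ k
  pairing-τ̂ γ (k , true)  | true  | eq = eq
  pairing-τ̂ γ (k , false) | true  | eq = cong negF eq
  pairing-τ̂ γ (k , true)  | false | eq = trans (cong negF eq) (negF-involutive (γ k))
  pairing-τ̂ γ (k , false) | false | eq = eq

module _ {c ℓ} (R : CommutativeRing c ℓ) where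
  open CommutativeRing R renaming (Carrier to A; refl to ≈-refl; sym to ≈-sym; trans to ≈-trans)
    hiding (zero)
  open Matrices R
  open CommutativeMonoidSum +-commutativeMonoid
    using (sum; sum-cong-≋; sum-remove; sum-replicate-zero; sum-permute)
  open import Relation.Binary.Reasoning.Setoid setoid

  record SumLaws (X : Index) : Set (c ⊔ ℓ) where
    open Index X
    field
      Sum-cong : ∀ {f g : I → A} → (∀ i → f i ≈ g i) → Sum f ≈ Sum g
      Sum-sift : ∀ i (f : I → A) → (∀ j → j ≢ i → f j ≈ 0#) → Sum f ≈ f i

  module PermutationSimilarity (X : Index) (laws : SumLaws X) where
    open Index X
    open SumLaws laws

    infixl 7 _∙_
    _∙_ : Mat X → Mat X → Mat X
    _∙_ = _·_ X

    idM-diag : ∀ i → idM X i i ≈ 1#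
    idM-diag i with i ≟I i
    ... | yes _   = ≈-refl
    ... | no i≢i = contradiction refl i≢i

    idM-offDiag : ∀ {i j} → i ≢ j → idM X i j ≈ 0#
    idM-offDiag {i} {j} i≢j with i ≟I j
    ... | yes i≡j = contradiction i≡j i≢j
    ... | no _    = ≈-refl

    permMat : (I → I) → Mat X
    permMat π a k = idM X (π a) k

    permMat-∙ˡ : ∀ π M a b → (permMat π ∙ M) a b ≈ M (π a) b
    permMat-∙ˡ π M a b = begin
      Sum (λ k → idM X (π a) k * M k b)  ≈⟨ Sum-sift (π a) _ off-πa ⟩
      idM X (π a) (π a) * M (π a) b      ≈⟨ *-congʳ (idM-diag (π a)) ⟩
      1# * M (π a) b                     ≈⟨ *-identityˡ _ ⟩
      M (π a) b                          ∎
      where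
      off-πa : ∀ k → k ≢ π a → idM X (π a) k * M k b ≈ 0#
      off-πa k k≢πa = ≈-trans (*-congʳ (idM-offDiag (k≢πa ∘ sym))) (zeroˡ _)

    module _ (σ : I ↔ I) where
      open Inverse σ using (to; from; strictlyInverseˡ; strictlyInverseʳ)

      permMat-∙ʳ : ∀ M a b → (M ∙ permMat to) a b ≈ M a (from b)
      permMat-∙ʳ M a b = begin
        Sum (λ k → M a k * idM X (to k) b)     ≈⟨ Sum-sift (from b) _ off-from-b ⟩
        M a (from b) * idM X (to (from b)) b  ≡⟨ cong (λ x → M a (from b) * idM X x b) (strictlyInverseˡ b) ⟩
        M a (from b) * idM X b b              ≈⟨ *-congˡ (idM-diag b) ⟩
        M a (from b) * 1#                     ≈⟨ *-identityʳ _ ⟩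
        M a (from b)                          ∎
        where
        off-from-b : ∀ k → k ≢ from b → M a k * idM X (to k) b ≈ 0#
        off-from-b k k≢ = ≈-trans (*-congˡ (idM-offDiag (λ tk≡b →
          k≢ (trans (sym (strictlyInverseʳ k)) (cong from tk≡b))))) (zeroʳ _)

      similar-by-permutation : ∀ {M N : Mat X} →
        (∀ i j → N (to i) (to j) ≈ M i j) → Similar X M N
      similar-by-permutation {M} {N} N∘σ≈M = P , Q , P∙Q≈id , Q∙P≈id , N≈PMQ
        where
        P Q : Mat X
        P = permMat from
        Q = permMat to

        P∙Q≈id : ∀ a b → (P ∙ Q) a b ≈ idM X a b
        P∙Q≈id a b = ≈-trans (permMat-∙ˡ from Q a b)
                           (reflexive (cong (λ x → idM X x b) (strictlyInverseˡ a)))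

        Q∙P≈id : ∀ a b → (Q ∙ P) a b ≈ idM X a b
        Q∙P≈id a b = ≈-trans (permMat-∙ˡ to P a b)
                           (reflexive (cong (λ x → idM X x b) (strictlyInverseʳ a)))

        N≈PMQ : ∀ a b → N a b ≈ (P ∙ M ∙ Q) a b
        N≈PMQ a b = ≈-sym (begin
          (P ∙ M ∙ Q) a b              ≈⟨ permMat-∙ʳ (P ∙ M) a b ⟩
          (P ∙ M) a (from b)           ≈⟨ permMat-∙ˡ from M a (from b) ⟩
          M (from a) (from b)          ≈⟨ N∘σ≈M (from a) (from b) ⟨
          N (to (from a)) (to (from b)) ≡⟨ cong₂ N (strictlyInverseˡ a) (strictlyInverseˡ b) ⟩
          N a b                        ∎)

  open PermutationSimilarity using (similar-by-permutation)

  sumFin≡sum : ∀ k (f : Fin k → A) → sumFin k f ≡ sum f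
  sumFin≡sum zero    f = refl
  sumFin≡sum (suc k) f = cong (f F.zero +_) (sumFin≡sum k (f ∘ F.suc))

  sum-sift : ∀ {k} i (f : Fin k → A) → (∀ j → j ≢ i → f j ≈ 0#) → sum f ≈ f i
  sum-sift {suc k} i f off-i = begin
    sum f                                  ≈⟨ sum-remove {i = i} f ⟩
    f i + sum (f ∘ punchIn i)              ≈⟨ +-congˡ (sum-cong-≋ (λ j → off-i _ (punchInᵢ≢i i j))) ⟩
    f i + sum (replicate k 0#)             ≈⟨ +-congˡ (sum-replicate-zero k) ⟩
    f i + 0#                               ≈⟨ +-identityʳ (f i) ⟩
    f i                                    ∎

  FinIx-laws : ∀ k → SumLaws (FinIx k)
  FinIx-laws k = record { Sum-cong = sumFin-cong ; Sum-sift = sumFin-sift }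
    where
    sumFin-cong : ∀ {f g : Fin k → A} → (∀ i → f i ≈ g i) → sumFin k f ≈ sumFin k g
    sumFin-cong {f} {g} f≈g = begin
      sumFin k f  ≡⟨ sumFin≡sum k f ⟩
      sum f       ≈⟨ sum-cong-≋ f≈g ⟩
      sum g       ≡⟨ sumFin≡sum k g ⟨
      sumFin k g  ∎

    sumFin-sift : ∀ i (f : Fin k → A) → (∀ j → j ≢ i → f j ≈ 0#) → sumFin k f ≈ f i
    sumFin-sift i f off-i = ≈-trans (reflexive (sumFin≡sum k f)) (sum-sift i f off-i)

  OEIx-laws : ∀ m → SumLaws (OEIx m)
  OEIx-laws m = record { Sum-cong = sumOE-cong ; Sum-sift = sumOE-sift }
    where
    open SumLaws (FinIx-laws m) using (Sum-cong; Sum-sift)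

    sumOE-cong : ∀ {f g : OEdge m → A} → (∀ e → f e ≈ g e) → sumOE m f ≈ sumOE m g
    sumOE-cong f≈g = Sum-cong (λ k → +-cong (f≈g (k , true)) (f≈g (k , false)))

    sumOE-sift : ∀ e (f : OEdge m → A) → (∀ e' → e' ≢ e → f e' ≈ 0#) → sumOE m f ≈ f e
    sumOE-sift (k , b) f off-e = ≈-trans (Sum-sift k _ off-k) (pair-sift b off-e)
      where
      off-k : ∀ j → j ≢ k → f (j , true) + f (j , false) ≈ 0#
      off-k j j≢k = ≈-trans (+-cong (off-e _ (j≢k ∘ cong proj₁)) (off-e _ (j≢k ∘ cong proj₁)))
                          (+-identityʳ 0#)

      pair-sift : ∀ b → (∀ e' → e' ≢ (k , b) → f e' ≈ 0#) → f (k , true) + f (k , false) ≈ f (k , b)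
      pair-sift true  off = ≈-trans (+-congˡ (off _ (λ ()))) (+-identityʳ _)
      pair-sift false off = ≈-trans (+-congʳ (off _ (λ ()))) (+-identityˡ _)

  sumOE-liftOE : ∀ {m} (π : Fin m ↔ Fin m) (p : Fin m → Bool) (f : OEdge m → A) →
                 sumOE m (f ∘ liftOE (Inverse.to π) p) ≈ sumOE m f
  sumOE-liftOE {m} π p f = begin
    sumOE m (f ∘ liftOE (Inverse.to π) p)  ≡⟨ sumFin≡sum m _ ⟩
    sum (λ k → f (to k , orient (p k) true) + f (to k , orient (p k) false))
      ≈⟨ sum-cong-≋ (λ k → edge-pair (p k) (to k)) ⟩
    sum (edge-pair-sum ∘ to)              ≈⟨ sum-permute edge-pair-sum π ⟨
    sum edge-pair-sum                     ≡⟨ sumFin≡sum m edge-pair-sum ⟨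
    sumOE m f                             ∎
    where
    open Inverse π using (to)

    edge-pair-sum : Fin m → A
    edge-pair-sum k = f (k , true) + f (k , false)

    edge-pair : ∀ q k → f (k , orient q true) + f (k , orient q false) ≈ edge-pair-sum k
    edge-pair true  k = ≈-refl
    edge-pair false k = +-comm _ _

  module AutomorphismInvariance {n m : ℕ} (G : Graph n m) (t : ℕ) (ε : A)
                               (τ : Automorphism G) (γ : C1 m t) where
    open Automorphism τ
    open AutomorphismOnOEdges τ

    χ-τ̂ : ∀ e → χ G t ε (act τ γ) (τ̂ e) ≡ χ G t ε γ e
    χ-τ̂ e = cong (λ x → ε ^ F.toℕ x) (pairing-τ̂ γ e)

    ⌊≟⌋-τv : ∀ x y → ⌊ τv x F.≟ τv y ⌋ ≡ ⌊ x F.≟ y ⌋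
    ⌊≟⌋-τv = ⌊≟⌋-injective F._≟_ F._≟_ (↔-injective vperm)

    Aγ-term : C1 m t → Fin n → Fin n → OEdge m → A
    Aγ-term β i j e = if ⌊ init G e F.≟ i ⌋ ∧ ⌊ term G e F.≟ j ⌋ then χ G t ε β e else 0#

    Aγ-term-τ̂ : ∀ i j e → Aγ-term (act τ γ) (τv i) (τv j) (τ̂ e) ≡ Aγ-term γ i j e
    Aγ-term-τ̂ i j e rewrite init-τ̂ e | term-τ̂ e | ⌊≟⌋-τv (init G e) i
                         | ⌊≟⌋-τv (term G e) j | χ-τ̂ e = refl

    Aγ-τ : ∀ i j → Aγ G t ε (act τ γ) (τv i) (τv j) ≈ Aγ G t ε γ i j
    Aγ-τ i j = ≈-trans (≈-sym (sumOE-liftOE eperm pos (Aγ-term (act τ γ) (τv i) (τv j))))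
                       (SumLaws.Sum-cong (OEIx-laws m) (reflexive ∘ Aγ-term-τ̂ i j))

    ⌊≟inv⌋-τ̂ : ∀ e e' → ⌊ τ̂ e' ≟OE inv G t ε (τ̂ e) ⌋ ≡ ⌊ e' ≟OE inv G t ε e ⌋
    ⌊≟inv⌋-τ̂ (k , b) e' =
      trans (cong (λ x → ⌊ τ̂ e' ≟OE x ⌋) (sym (τ̂-reverse k b)))
            (⌊≟⌋-injective _≟OE_ _≟OE_ (↔-injective τ̂-↔) e' (k , not b))

    feeds-τ̂ : ∀ e e' → feeds G t ε (τ̂ e) (τ̂ e') ≡ feeds G t ε e e'
    feeds-τ̂ e e' rewrite term-τ̂ e | init-τ̂ e' =
      cong₂ _∧_ (cong not (⌊≟inv⌋-τ̂ e e')) (⌊≟⌋-τv (term G e) (init G e'))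

    W1-τ : ∀ e e' → W1 G t ε (act τ γ) (τ̂ e) (τ̂ e') ≈ W1 G t ε γ e e'
    W1-τ e e' rewrite feeds-τ̂ e e' | χ-τ̂ e = ≈-refl

    Aγ-similar : Similar (FinIx n) (Aγ G t ε γ) (Aγ G t ε (act τ γ))
    Aγ-similar = similar-by-permutation (FinIx n) (FinIx-laws n) vperm Aγ-τ

    W1-similar : Similar (OEIx m) (W1 G t ε γ) (W1 G t ε (act τ γ))
    W1-similar = similar-by-permutation (OEIx m) (OEIx-laws m) τ̂-↔ W1-τ

lemma6p11 : ∀ {c ℓ} (R : CommutativeRing c ℓ) {n m : ℕ} (G : Graph n m) → Connected G →
    (t : ℕ) → 2 ≤ t →
    (ε : CommutativeRing.Carrier R) →
    CommutativeRing._≈_ R (Matrices._^_ R ε t) (CommutativeRing.1# R) →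
    (τ : Automorphism G) (γ : C1 m t) →
    Matrices.Similar R (Matrices.FinIx R n)
      (Matrices.Aγ R G t ε γ) (Matrices.Aγ R G t ε (act τ γ))
    × Matrices.Similar R (Matrices.OEIx R m)
      (Matrices.W1 R G t ε γ) (Matrices.W1 R G t ε (act τ γ))
lemma6p11 R G _ t _ ε _ τ γ = Aγ-similar , W1-similar
  where open AutomorphismInvariance R G t ε τ γ using (Aγ-similar; W1-similar)
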